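{- Let $n \ge 1$ and consider the following procedure on an array $A[1..n]$ of pairwise distinct elements from a totally ordered set: for $i = 1, \ldots, n$, for $j = 1, \ldots, n$, if $A[i] < A[j]$ then swap $A[i]$ and $A[j]$. If the input array has $I$ inversions, then the procedure performs at most $I + 2(n-1)$ swaps. Moreover this bound is tight: there is an input of length $n$ (of pairwise distinct elements) on which the procedure performs exactly $I + 2(n-1)$ swaps, where $I$ is the number of inversions of that input.
   Context: An inversion of an array $A[1..n]$ is a pair of indices $(p,q)$ with $p<q$ and $A[p]>A[q]$. The loops are nested in the standard way (the full inner loop over $j$ runs for each $i$ in increasing order), each comparison uses the current array contents, and a swap is counted each time the condition $A[i] < A[j]$ holds. -}

module Defs where

open import Level using (Level)
open import Data.Nat using (ℕ; zero; suc; _+_)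
open import Data.Fin using (Fin)
open import Data.Fin.Base using () renaming (_<_ to _<ᶠ_)
open import Data.Vec using (Vec; lookup; _[_]≔_)
open import Data.List using (List; foldl; length; filter; cartesianProduct)
open import Data.List.Base using (allFin)
open import Data.Product using (_×_; _,_; proj₁; proj₂)
open import Relation.Nullary using (yes; no; ¬_)
open import Relation.Binary using (StrictTotalOrder)
open import Relation.Binary.PropositionalEquality using (_≡_)
import Data.Fin.Properties as FinP

module _ {c ℓ₁ ℓ₂ : Level} (O : StrictTotalOrder c ℓ₁ ℓ₂) where
  open StrictTotalOrder O renaming (Carrier to X)

  Distinct : {n : ℕ} → Vec X n → Set _
  Distinct {n} A = (p q : Fin n) → ¬ (p ≡ q) → ¬ (lookup A p ≈ lookup A q)

  inversions : {n : ℕ} → Vec X n → ℕ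
  inversions {n} A =
    length (filter (λ pq → (proj₁ pq FinP.<? proj₂ pq) Relation.Nullary.×-dec
                           (lookup A (proj₂ pq) <? lookup A (proj₁ pq)))
                   (cartesianProduct (allFin n) (allFin n)))

  swap : {n : ℕ} → Vec X n → Fin n → Fin n → Vec X n
  swap A i j = (A [ i ]≔ lookup A j) [ j ]≔ lookup A i

  step : {n : ℕ} → Fin n → Vec X n × ℕ → Fin n → Vec X n × ℕ
  step i (A , k) j with lookup A i <? lookup A j
  ... | yes _ = swap A i j , suc k
  ... | no  _ = A , k

  inner : {n : ℕ} → Vec X n × ℕ → Fin n → Vec X n × ℕ
  inner {n} s i = foldl (step i) s (allFin n)

  run : {n : ℕ} → Vec X n → Vec X n × ℕ
  run {n} A = foldl inner (A , 0) (allFin n)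

  swaps : {n : ℕ} → Vec X n → ℕ
  swaps A = proj₂ (run A)

module Submission where

-- Positions are 0-based. During pass 0 the entry at 0 is the running maximum, so each swap (0, j)
-- puts a new maximum in front of entries that are all smaller than it: it adds at most one inversion,
-- and there are at most n - 1 such swaps. After pass i - 1 the maximum sits at position i - 1, and
-- pass i swaps only with positions j < i, each swap removing an inversion, until j = i - 1, where
-- distinctness forces the swap moving the maximum to position i; afterwards nothing is swapped.
-- Hence swaps + inversions grows by at most 2 per swap of pass 0 and never later, which gives the
-- bound; every later pass swaps at least once, so on an increasing input (no inversions, where
-- pass 0 swaps at every j >= 1) there are exactly 2 (n - 1) swaps.

open import Defs
open import Level using (Level; _⊔_)
open import Data.Bool using (true; false; if_then_else_)
open import Data.Nat using (ℕ; zero; suc; _+_; _*_; _∸_; _≤_; _<_; _≥_; z≤n; s≤s; z<s; s<s)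
open import Data.Nat.Properties hiding (_≟_; _<?_)
open import Data.Nat.Tactic.RingSolver using (solve-∀)
open import Data.Fin using (Fin; zero; suc; toℕ; inject₁) renaming (_<_ to _<ᶠ_)
open import Data.Fin.Properties as Fin using (_≟_; toℕ-injective; toℕ-inject₁; toℕ<n)
  renaming (_<?_ to _<ᶠ?_; <-irrefl to <ᶠ-irrefl; <-asym to <ᶠ-asym; <-trans to <ᶠ-trans; <-cmp to <ᶠ-cmp; <⇒≢ to <ᶠ⇒≢)
open import Data.Fin.Permutation.Components using (transpose; transpose-inverse)
open import Data.List using (List; _++_; allFin; foldl; tabulate; filter; length; map; cartesianProduct)
open import Data.List.Properties using (length-++; filter-++; map-tabulate)
open import Data.Vec as Vec using (Vec; lookup; _[_]≔_)
open import Data.Vec.Properties using (lookup∘update; lookup∘update′; lookup∘tabulate)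
open import Data.Product using (_×_; Σ; _,_; proj₁; proj₂)
open import Data.Sum as Sum using (_⊎_; inj₁; inj₂)
open import Data.Empty using (⊥-elim)
open import Function using (_∘_)
open import Relation.Nullary using (Dec; does; yes; no; ¬_; ¬?; _×-dec_)
open import Relation.Nullary.Decidable using (dec-true; dec-false)
open import Relation.Unary using (Pred; Decidable)
open import Relation.Binary using (StrictTotalOrder; tri<; tri≈; tri>)
open import Relation.Binary.PropositionalEquality
open import Algebra.Properties.CommutativeSemigroup +-commutativeSemigroup using (x∙yz≈y∙xz)
open import Algebra.Properties.CommutativeMonoid.Sum +-0-commutativeMonoid
  using (sum; sum-syntax; sum-cong-≗; ∑-distrib-+; sum-replicate-zero)

⟦_⟧ : ∀ {p} {P : Set p} → Dec P → ℕ
⟦ P? ⟧ = if does P? then 1 else 0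

⟦⟧-yes : ∀ {p} {P : Set p} (P? : Dec P) → P → ⟦ P? ⟧ ≡ 1
⟦⟧-yes P? x rewrite dec-true P? x = refl

⟦⟧-no : ∀ {p} {P : Set p} (P? : Dec P) → ¬ P → ⟦ P? ⟧ ≡ 0
⟦⟧-no P? x rewrite dec-false P? x = refl

⟦⟧≤1 : ∀ {p} {P : Set p} (P? : Dec P) → ⟦ P? ⟧ ≤ 1
⟦⟧≤1 (yes _) = s≤s z≤n
⟦⟧≤1 (no _) = z≤n

length-filter-tabulate : ∀ {a p} {A : Set a} {P : Pred A p} (P? : Decidable P) {n} (h : Fin n → A) →
  length (filter P? (tabulate h)) ≡ ∑[ r < n ] ⟦ P? (h r) ⟧
length-filter-tabulate P? {zero} h = refl
length-filter-tabulate P? {suc n} h with does (P? (h zero))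
... | true = cong suc (length-filter-tabulate P? (h ∘ suc))
... | false = length-filter-tabulate P? (h ∘ suc)

length-filter-cartesianProduct : ∀ {a b p} {A : Set a} {B : Set b} {P : Pred (A × B) p} (P? : Decidable P)
  {m} (g : Fin m → A) (ys : List B) →
  length (filter P? (cartesianProduct (tabulate g) ys)) ≡ ∑[ x < m ] length (filter P? (map (g x ,_) ys))
length-filter-cartesianProduct P? {zero} g ys = refl
length-filter-cartesianProduct P? {suc m} g ys = begin
  length (filter P? (row ++ rest))                  ≡⟨ cong length (filter-++ P? row rest) ⟩
  length (filter P? row ++ filter P? rest)          ≡⟨ length-++ (filter P? row) ⟩
  length (filter P? row) + length (filter P? rest)  ≡⟨ cong (length (filter P? row) +_)
                                                            (length-filter-cartesianProduct P? (g ∘ suc) ys) ⟩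
  length (filter P? row) + ∑[ x < m ] length (filter P? (map (g (suc x) ,_) ys)) ∎
  where
  open ≡-Reasoning
  row = map (g zero ,_) ys
  rest = cartesianProduct (tabulate (g ∘ suc)) ys

length-filter-allPairs : ∀ {p} {n} {P : Pred (Fin n × Fin n) p} (P? : Decidable P) →
  length (filter P? (cartesianProduct (allFin n) (allFin n))) ≡ ∑[ x < n ] ∑[ y < n ] ⟦ P? (x , y) ⟧
length-filter-allPairs {n = n} P? =
  trans (length-filter-cartesianProduct P? (λ x → x) (allFin n))
        (sum-cong-≗ λ x → trans (cong (λ l → length (filter P? l)) (map-tabulate (λ y → y) (x ,_)))
                                (length-filter-tabulate P? (x ,_)))

sum-mono-≤ : ∀ {n} {f g : Fin n → ℕ} → (∀ r → f r ≤ g r) → sum f ≤ sum g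
sum-mono-≤ {zero} f≤g = z≤n
sum-mono-≤ {suc n} f≤g = +-mono-≤ (f≤g zero) (sum-mono-≤ (f≤g ∘ suc))

sum-zero : ∀ {n} {f : Fin n → ℕ} → (∀ r → f r ≡ 0) → sum f ≡ 0
sum-zero {n} f≡0 = trans (sum-cong-≗ f≡0) (sum-replicate-zero n)

off : ∀ {n} → Fin n → Fin n → ℕ
off i r = ⟦ ¬? (r ≟ i) ⟧

off-≢ : ∀ {n} {i r : Fin n} → r ≢ i → off i r ≡ 1
off-≢ {i = i} {r} r≢i = ⟦⟧-yes (¬? (r ≟ i)) r≢i

sum-split : ∀ {n} (i : Fin n) (h : Fin n → ℕ) → sum h ≡ h i + ∑[ r < n ] (off i r * h r)
sum-split zero h = cong (h zero +_) (sum-cong-≗ (λ r → sym (*-identityˡ (h (suc r)))))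
sum-split {suc n} (suc i) h = begin
  h zero + sum (h ∘ suc)                       ≡⟨ cong (h zero +_) (sum-split i (h ∘ suc)) ⟩
  h zero + (h (suc i) + rest)                  ≡⟨ x∙yz≈y∙xz (h zero) (h (suc i)) rest ⟩
  h (suc i) + (h zero + rest)                  ≡⟨ cong (λ a → h (suc i) + (a + rest)) (*-identityˡ (h zero)) ⟨
  h (suc i) + (1 * h zero + rest)              ∎
  where
  open ≡-Reasoning
  rest = ∑[ r < n ] (off i r * h (suc r))

off₂ : ∀ {n} → Fin n → Fin n → Fin n → ℕ
off₂ i j r = off i r * off j r

off₂-cases : ∀ {n} (i j r : Fin n) → off₂ i j r ≡ 0 ⊎ (off₂ i j r ≡ 1 × r ≢ i × r ≢ j)
off₂-cases i j r with r ≟ i | r ≟ j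
... | yes _   | _       = inj₁ refl
... | no _    | yes _   = inj₁ refl
... | no r≢i  | no r≢j  = inj₂ (refl , r≢i , r≢j)

sum-split₂ : ∀ {n} {i j : Fin n} → i ≢ j → (h : Fin n → ℕ) →
             sum h ≡ h i + h j + ∑[ r < n ] (off₂ i j r * h r)
sum-split₂ {n} {i} {j} i≢j h = begin
  sum h                                                           ≡⟨ sum-split i h ⟩
  h i + ∑[ r < n ] (off i r * h r)                                ≡⟨ cong (h i +_) (sum-split j (λ r → off i r * h r)) ⟩
  h i + (off i j * h j + ∑[ r < n ] (off j r * (off i r * h r)))  ≡⟨ cong₂ (λ a b → h i + (a + b)) j-term reweigh ⟩
  h i + (h j + ∑[ r < n ] (off₂ i j r * h r))                     ≡⟨ sym (+-assoc (h i) (h j) _) ⟩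
  h i + h j + ∑[ r < n ] (off₂ i j r * h r)                       ∎
  where
  open ≡-Reasoning
  j-term : off i j * h j ≡ h j
  j-term = trans (cong (_* h j) (off-≢ (i≢j ∘ sym))) (*-identityˡ (h j))
  reweigh : ∑[ r < n ] (off j r * (off i r * h r)) ≡ ∑[ r < n ] (off₂ i j r * h r)
  reweigh = sum-cong-≗ λ r → trans (sym (*-assoc (off j r) (off i r) (h r))) (cong (_* h r) (*-comm (off j r) (off i r)))

sum-weighted-+ : ∀ {n} (w f g : Fin n → ℕ) →
                 ∑[ r < n ] (w r * (f r + g r)) ≡ ∑[ r < n ] (w r * f r) + ∑[ r < n ] (w r * g r)
sum-weighted-+ w f g =
  trans (sum-cong-≗ (λ r → *-distribˡ-+ (w r) (f r) (g r))) (∑-distrib-+ (λ r → w r * f r) (λ r → w r * g r))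

module _ {n : ℕ} (i j : Fin n) where

  sum-off₂-mono-≤ : {f g : Fin n → ℕ} → (∀ r → r ≢ i → r ≢ j → f r ≤ g r) →
                    ∑[ r < n ] (off₂ i j r * f r) ≤ ∑[ r < n ] (off₂ i j r * g r)
  sum-off₂-mono-≤ {f} {g} f≤g = sum-mono-≤ weighted
    where
    weighted : ∀ r → off₂ i j r * f r ≤ off₂ i j r * g r
    weighted r with off₂-cases i j r
    ... | inj₁ w≡0 rewrite w≡0 = z≤n
    ... | inj₂ (w≡1 , r≢i , r≢j) rewrite w≡1 = *-monoʳ-≤ 1 (f≤g r r≢i r≢j)

  sum-off₂-cong : {f g : Fin n → ℕ} → (∀ r → r ≢ i → r ≢ j → f r ≡ g r) →
                  ∑[ r < n ] (off₂ i j r * f r) ≡ ∑[ r < n ] (off₂ i j r * g r)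
  sum-off₂-cong f≡g = ≤-antisym (sum-off₂-mono-≤ (λ r r≢i r≢j → ≤-reflexive (f≡g r r≢i r≢j)))
                               (sum-off₂-mono-≤ (λ r r≢i r≢j → ≤-reflexive (sym (f≡g r r≢i r≢j))))

  corner : (Fin n → Fin n → ℕ) → ℕ
  corner f = f i i + f i j + f j i + f j j

  cross : (Fin n → Fin n → ℕ) → Fin n → ℕ
  cross f r = f r i + f r j + f i r + f j r

  interior : (Fin n → Fin n → ℕ) → ℕ
  interior f = ∑[ p < n ] (off₂ i j p * ∑[ q < n ] (off₂ i j q * f p q))

  sum₂-split : i ≢ j → (f : Fin n → Fin n → ℕ) →
               ∑[ p < n ] sum (f p) ≡ corner f + ∑[ r < n ] (off₂ i j r * cross f r) + interior f
  sum₂-split i≢j f = begin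
    ∑[ p < n ] sum (f p)                                    ≡⟨ sum-cong-≗ (λ p → sum-split₂ i≢j (f p)) ⟩
    ∑[ p < n ] (f p i + f p j + row p)                      ≡⟨ ∑-distrib-+ (λ p → f p i + f p j) row ⟩
    ∑[ p < n ] (f p i + f p j) + sum row                    ≡⟨ cong (_+ sum row) (∑-distrib-+ (λ p → f p i) (λ p → f p j)) ⟩
    ∑[ p < n ] f p i + ∑[ p < n ] f p j + sum row           ≡⟨ cong₂ _+_ (cong₂ _+_ (sum-split₂ i≢j _) (sum-split₂ i≢j _))
                                                                         (sum-split₂ i≢j row) ⟩
    (f i i + f j i + colᵢ) + (f i j + f j j + colⱼ) + (row i + row j + interior f)
                                                            ≡⟨ regroup (f i i) (f j i) (f i j) (f j j) colᵢ colⱼ (row i) (row j) _ ⟩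
    corner f + (colᵢ + colⱼ + row i + row j) + interior f  ≡⟨ cong (λ x → corner f + x + interior f) (sym cross-sum) ⟩
    corner f + ∑[ r < n ] (off₂ i j r * cross f r) + interior f ∎
    where
    open ≡-Reasoning
    row : Fin n → ℕ
    row p = ∑[ q < n ] (off₂ i j q * f p q)
    colᵢ colⱼ : ℕ
    colᵢ = ∑[ p < n ] (off₂ i j p * f p i)
    colⱼ = ∑[ p < n ] (off₂ i j p * f p j)
    regroup : ∀ a b c d x y z u t → a + b + x + (c + d + y) + (z + u + t) ≡ a + c + b + d + (x + y + z + u) + t
    regroup = solve-∀
    cross-sum : ∑[ r < n ] (off₂ i j r * cross f r) ≡ colᵢ + colⱼ + row i + row j
    cross-sum = begin
      ∑[ r < n ] (off₂ i j r * cross f r)    ≡⟨ sum-weighted-+ (off₂ i j) _ (f j) ⟩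
      _ + row j                              ≡⟨ cong (_+ row j) (sum-weighted-+ (off₂ i j) _ (f i)) ⟩
      _ + row i + row j                      ≡⟨ cong (λ x → x + row i + row j) (sum-weighted-+ (off₂ i j) _ _) ⟩
      colᵢ + colⱼ + row i + row j            ∎

  sum₂-compare : i ≢ j → (f g : Fin n → Fin n → ℕ) {c d : ℕ} →
    (∀ p q → p ≢ i → p ≢ j → q ≢ i → q ≢ j → g p q ≡ f p q) →
    (∀ r → r ≢ i → r ≢ j → cross g r ≤ cross f r) →
    corner g + c ≤ corner f + d →
    ∑[ p < n ] sum (g p) + c ≤ ∑[ p < n ] sum (f p) + d
  sum₂-compare i≢j f g {c} {d} interior-eq cross-≤ corner-≤ = begin
    ∑[ p < n ] sum (g p) + c                                     ≡⟨ cong (_+ c) (sum₂-split i≢j g) ⟩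
    corner g + crossing g + interior g + c                       ≡⟨ move-last (corner g) _ _ c ⟩
    corner g + c + crossing g + interior g                       ≤⟨ +-mono-≤ (+-mono-≤ corner-≤ crossing-≤) (≤-reflexive interior-≡) ⟩
    corner f + d + crossing f + interior f                       ≡⟨ move-last (corner f) _ _ d ⟨
    corner f + crossing f + interior f + d                       ≡⟨ cong (_+ d) (sym (sum₂-split i≢j f)) ⟩
    ∑[ p < n ] sum (f p) + d                                     ∎
    where
    open ≤-Reasoning
    crossing : (Fin n → Fin n → ℕ) → ℕ
    crossing h = ∑[ r < n ] (off₂ i j r * cross h r)
    move-last : ∀ a x t c → a + x + t + c ≡ a + c + x + t
    move-last = solve-∀
    crossing-≤ : crossing g ≤ crossing f
    crossing-≤ = sum-off₂-mono-≤ cross-≤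
    interior-≡ : interior g ≡ interior f
    interior-≡ = sum-off₂-cong λ p p≢i p≢j → sum-off₂-cong (λ q → interior-eq p q p≢i p≢j)

toℕ<1+toℕ⇒<∨≡ : ∀ {n} {r x : Fin n} → toℕ r < suc (toℕ x) → toℕ r < toℕ x ⊎ r ≡ x
toℕ<1+toℕ⇒<∨≡ = Sum.map₂ toℕ-injective ∘ m<1+n⇒m<n∨m≡n

transpose-injective : ∀ {n} (p q : Fin n) {r s} → transpose p q r ≡ transpose p q s → r ≡ s
transpose-injective p q τr≡τs =
  trans (sym (transpose-inverse q p)) (trans (cong (transpose q p) τr≡τs) (transpose-inverse q p))

foldl-tabulate-invariant : ∀ {a b ℓ} {S : Set a} {B : Set b} (P : ℕ → S → Set ℓ) {f : S → B → S} {n}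
  (g : Fin n → B) {s : S} → (∀ x s → P (toℕ x) s → P (suc (toℕ x)) (f s (g x))) →
  P 0 s → P n (foldl f s (tabulate g))
foldl-tabulate-invariant P {n = zero} g step P₀ = P₀
foldl-tabulate-invariant P {n = suc n} g step P₀ =
  foldl-tabulate-invariant (P ∘ suc) (g ∘ suc) (λ x → step (suc x)) (step zero _ P₀)

module _ {c ℓ₁ ℓ₂ : Level} (O : StrictTotalOrder c ℓ₁ ℓ₂) where
  open StrictTotalOrder O using (_≈_; _<?_; compare; irrefl; asym; module Eq)
    renaming (Carrier to X; _<_ to _⊏_; trans to ⊏-trans)

  inverted : ∀ {n} → Fin n → Fin n → X → X → ℕ
  inverted p q a b = ⟦ (p <ᶠ? q) ×-dec (b <? a) ⟧

  invertedAt : ∀ {n} → (Fin n → X) → Fin n → Fin n → ℕ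
  invertedAt φ p q = inverted p q (φ p) (φ q)

  inversionsOf : ∀ {n} → (Fin n → X) → ℕ
  inversionsOf {n} φ = ∑[ p < n ] ∑[ q < n ] invertedAt φ p q

  inversions≡inversionsOf : ∀ {n} (A : Vec X n) → inversions O A ≡ inversionsOf (lookup A)
  inversions≡inversionsOf A =
    length-filter-allPairs (λ pq → (proj₁ pq <ᶠ? proj₂ pq) ×-dec (lookup A (proj₂ pq) <? lookup A (proj₁ pq)))

  inverted-< : ∀ {n} {p q : Fin n} → p <ᶠ q → ∀ a b → inverted p q a b ≡ ⟦ b <? a ⟧
  inverted-< {p = p} {q} p<q a b rewrite dec-true (p <ᶠ? q) p<q = refl

  inverted-≮ : ∀ {n} {p q : Fin n} → ¬ p <ᶠ q → ∀ a b → inverted p q a b ≡ 0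
  inverted-≮ {p = p} {q} p≮q a b rewrite dec-false (p <ᶠ? q) p≮q = refl

  record Exchange {n : ℕ} (φ ψ : Fin n → X) (p q : Fin n) : Set c where
    field
      at-p : ψ p ≡ φ q
      at-q : ψ q ≡ φ p
      elsewhere : ∀ {r} → r ≢ p → r ≢ q → ψ r ≡ φ r

  exchange-sym : ∀ {n} {φ ψ : Fin n → X} {p q} → Exchange φ ψ p q → Exchange φ ψ q p
  exchange-sym e = record { at-p = at-q ; at-q = at-p ; elsewhere = λ r≢q r≢p → elsewhere r≢p r≢q }
    where open Exchange e

  -- The left side counts the inversions c forms with a and b in the arrangement b c a,
  -- the right side those in a c b.
  middle-inversions-≤-inverted : ∀ {a b} → b ⊏ a → ∀ c → ⟦ a <? c ⟧ + ⟦ c <? b ⟧ ≤ ⟦ b <? c ⟧ + ⟦ c <? a ⟧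
  middle-inversions-≤-inverted {a} {b} b⊏a c with a <? c
  ... | yes a⊏c rewrite ⟦⟧-yes (b <? c) (⊏-trans b⊏a a⊏c) | ⟦⟧-no (c <? b) (asym (⊏-trans b⊏a a⊏c)) = s≤s z≤n
  ... | no _ with c <? b
  ...   | yes c⊏b rewrite ⟦⟧-yes (c <? a) (⊏-trans c⊏b b⊏a) = m≤n+m 1 ⟦ b <? c ⟧
  ...   | no _ = z≤n

  middle-inversions-≤-below : ∀ {a c} → c ⊏ a → ∀ b → ⟦ a <? c ⟧ + ⟦ c <? b ⟧ ≤ ⟦ b <? c ⟧ + ⟦ c <? a ⟧
  middle-inversions-≤-below {a} {c} c⊏a b rewrite ⟦⟧-no (a <? c) (asym c⊏a) | ⟦⟧-yes (c <? a) c⊏a =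
    ≤-trans (⟦⟧≤1 (c <? b)) (m≤n+m 1 ⟦ b <? c ⟧)

  module _ {n : ℕ} {p q : Fin n} (p<q : p <ᶠ q) where

    corner-inverted : ∀ φ → corner p q (invertedAt φ) ≡ 0 + ⟦ φ q <? φ p ⟧ + 0 + 0
    corner-inverted φ
      rewrite inverted-≮ {p = p} (<ᶠ-irrefl refl) (φ p) (φ p) | inverted-< p<q (φ p) (φ q)
            | inverted-≮ (<ᶠ-asym p<q) (φ q) (φ p) | inverted-≮ {p = q} (<ᶠ-irrefl refl) (φ q) (φ q) = refl

    cross-below : ∀ φ {r} → r <ᶠ p → cross p q (invertedAt φ) r ≡ ⟦ φ p <? φ r ⟧ + ⟦ φ q <? φ r ⟧ + 0 + 0
    cross-below φ {r} r<p
      rewrite inverted-< r<p (φ r) (φ p) | inverted-< (<ᶠ-trans r<p p<q) (φ r) (φ q)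
            | inverted-≮ (<ᶠ-asym r<p) (φ p) (φ r) | inverted-≮ (<ᶠ-asym (<ᶠ-trans r<p p<q)) (φ q) (φ r) = refl

    cross-between : ∀ φ {r} → p <ᶠ r → r <ᶠ q → cross p q (invertedAt φ) r ≡ 0 + ⟦ φ q <? φ r ⟧ + ⟦ φ r <? φ p ⟧ + 0
    cross-between φ {r} p<r r<q
      rewrite inverted-≮ (<ᶠ-asym p<r) (φ r) (φ p) | inverted-< r<q (φ r) (φ q)
            | inverted-< p<r (φ p) (φ r) | inverted-≮ (<ᶠ-asym r<q) (φ q) (φ r) = refl

    cross-above : ∀ φ {r} → q <ᶠ r → cross p q (invertedAt φ) r ≡ 0 + 0 + ⟦ φ r <? φ p ⟧ + ⟦ φ r <? φ q ⟧
    cross-above φ {r} q<r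
      rewrite inverted-≮ (<ᶠ-asym (<ᶠ-trans p<q q<r)) (φ r) (φ p) | inverted-≮ (<ᶠ-asym q<r) (φ r) (φ q)
            | inverted-< (<ᶠ-trans p<q q<r) (φ p) (φ r) | inverted-< q<r (φ q) (φ r) = refl

    -- Exchanging the entries at p < q can change the inversion count only through the pair (p, q)
    -- and the pairs joining p or q to a position strictly between them.
    inversionsOf-exchange : ∀ {φ ψ} → Exchange φ ψ p q →
      (∀ r → p <ᶠ r → r <ᶠ q → ⟦ φ p <? φ r ⟧ + ⟦ φ r <? φ q ⟧ ≤ ⟦ φ q <? φ r ⟧ + ⟦ φ r <? φ p ⟧) →
      inversionsOf ψ + ⟦ φ q <? φ p ⟧ ≤ inversionsOf φ + ⟦ φ p <? φ q ⟧
    inversionsOf-exchange {φ} {ψ} e between =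
      sum₂-compare p q (<ᶠ⇒≢ p<q) (invertedAt φ) (invertedAt ψ) interior-≡ cross-≤ corner-≤
      where
      open Exchange e
      interior-≡ : ∀ p' q' → p' ≢ p → p' ≢ q → q' ≢ p → q' ≢ q → invertedAt ψ p' q' ≡ invertedAt φ p' q'
      interior-≡ p' q' p'≢p p'≢q q'≢p q'≢q = cong₂ (inverted p' q') (elsewhere p'≢p p'≢q) (elsewhere q'≢p q'≢q)
      corner-≤ : corner p q (invertedAt ψ) + ⟦ φ q <? φ p ⟧ ≤ corner p q (invertedAt φ) + ⟦ φ p <? φ q ⟧
      corner-≤ rewrite corner-inverted ψ | corner-inverted φ | at-p | at-q =
        ≤-reflexive (swap-ends ⟦ φ p <? φ q ⟧ ⟦ φ q <? φ p ⟧)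
        where
        swap-ends : ∀ x y → x + 0 + 0 + y ≡ y + 0 + 0 + x
        swap-ends = solve-∀
      cross-≤ : ∀ r → r ≢ p → r ≢ q → cross p q (invertedAt ψ) r ≤ cross p q (invertedAt φ) r
      cross-≤ r r≢p r≢q with <ᶠ-cmp r p | <ᶠ-cmp r q
      ... | tri< r<p _ _ | _ rewrite cross-below ψ r<p | cross-below φ r<p | at-p | at-q | elsewhere r≢p r≢q =
        ≤-reflexive (cong (λ x → x + 0 + 0) (+-comm ⟦ φ q <? φ r ⟧ ⟦ φ p <? φ r ⟧))
      ... | tri≈ _ r≡p _ | _ = ⊥-elim (r≢p r≡p)
      ... | tri> _ _ p<r | tri< r<q _ _ rewrite cross-between ψ p<r r<q | cross-between φ p<r r<q | at-p | at-q | elsewhere r≢p r≢q =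
        +-monoˡ-≤ 0 (between r p<r r<q)
      ... | tri> _ _ _ | tri≈ _ r≡q _ = ⊥-elim (r≢q r≡q)
      ... | tri> _ _ _ | tri> _ _ q<r rewrite cross-above ψ q<r | cross-above φ q<r | at-p | at-q | elsewhere r≢p r≢q =
        ≤-reflexive (+-comm ⟦ φ r <? φ q ⟧ ⟦ φ r <? φ p ⟧)

    inversionsOf-exchange-inverted : ∀ {φ ψ} → Exchange φ ψ p q → φ q ⊏ φ p → inversionsOf ψ < inversionsOf φ
    inversionsOf-exchange-inverted {φ} {ψ} e φq⊏φp = begin
      suc (inversionsOf ψ)                      ≡⟨ +-comm 1 _ ⟩
      inversionsOf ψ + 1                        ≡⟨ cong (inversionsOf ψ +_) (⟦⟧-yes (φ q <? φ p) φq⊏φp) ⟨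
      inversionsOf ψ + ⟦ φ q <? φ p ⟧           ≤⟨ inversionsOf-exchange e (λ r _ _ → middle-inversions-≤-inverted φq⊏φp (φ r)) ⟩
      inversionsOf φ + ⟦ φ p <? φ q ⟧           ≡⟨ cong (inversionsOf φ +_) (⟦⟧-no (φ p <? φ q) (asym φq⊏φp)) ⟩
      inversionsOf φ + 0                        ≡⟨ +-identityʳ _ ⟩
      inversionsOf φ                            ∎
      where open ≤-Reasoning

    inversionsOf-exchange-ordered : ∀ {φ ψ} → Exchange φ ψ p q → φ p ⊏ φ q →
      (∀ r → p <ᶠ r → r <ᶠ q → φ r ⊏ φ p) → inversionsOf ψ ≤ suc (inversionsOf φ)
    inversionsOf-exchange-ordered {φ} {ψ} e φp⊏φq below = begin
      inversionsOf ψ                            ≡⟨ +-identityʳ _ ⟨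
      inversionsOf ψ + 0                        ≡⟨ cong (inversionsOf ψ +_) (⟦⟧-no (φ q <? φ p) (asym φp⊏φq)) ⟨
      inversionsOf ψ + ⟦ φ q <? φ p ⟧           ≤⟨ inversionsOf-exchange e (λ r p<r r<q → middle-inversions-≤-below (below r p<r r<q) (φ q)) ⟩
      inversionsOf φ + ⟦ φ p <? φ q ⟧           ≡⟨ cong (inversionsOf φ +_) (⟦⟧-yes (φ p <? φ q) φp⊏φq) ⟩
      inversionsOf φ + 1                        ≡⟨ +-comm _ 1 ⟩
      suc (inversionsOf φ)                      ∎
      where open ≤-Reasoning

  exchange-transpose : ∀ {n} {φ ψ : Fin n → X} {p q} → Exchange φ ψ p q → ∀ r → ψ r ≡ φ (transpose p q r)
  exchange-transpose {p = p} {q} e r with r ≟ p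
  ... | yes refl = Exchange.at-p e
  ... | no r≢p with r ≟ q
  ...   | yes refl = Exchange.at-q e
  ...   | no r≢q = Exchange.elsewhere e r≢p r≢q

  swap-exchange : ∀ {n} (A : Vec X n) {i j} → i ≢ j → Exchange (lookup A) (lookup (swap O A i j)) i j
  swap-exchange A {i} {j} i≢j = record
    { at-p = trans (lookup∘update′ i≢j (A [ i ]≔ lookup A j) (lookup A i)) (lookup∘update i A (lookup A j))
    ; at-q = lookup∘update j (A [ i ]≔ lookup A j) (lookup A i)
    ; elsewhere = λ r≢i r≢j →
        trans (lookup∘update′ r≢j (A [ i ]≔ lookup A j) (lookup A i)) (lookup∘update′ r≢i A (lookup A j))
    }

  swap-distinct : ∀ {n} (A : Vec X n) {i j} → i ≢ j → Distinct O A → Distinct O (swap O A i j)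
  swap-distinct A {i} {j} i≢j distinct r s r≢s Br≈Bs =
    distinct (transpose i j r) (transpose i j s) (r≢s ∘ transpose-injective i j)
             (subst₂ _≈_ (exchange-transpose e r) (exchange-transpose e s) Br≈Bs)
    where e = swap-exchange A i≢j

  IsMax : ∀ {n} → Vec X n → Fin n → Set ℓ₂
  IsMax A m = ∀ r → ¬ lookup A m ⊏ lookup A r

  swap-isMax : ∀ {n} (A : Vec X n) {i j m m′} → i ≢ j → IsMax A m →
               lookup (swap O A i j) m′ ≡ lookup A m → IsMax (swap O A i j) m′
  swap-isMax A {i} {j} i≢j max B≡A r Bm′⊏Br =
    max (transpose i j r) (subst₂ _⊏_ B≡A (exchange-transpose (swap-exchange A i≢j) r) Bm′⊏Br)

  distinct-≮⇒> : ∀ {n} (A : Vec X n) → Distinct O A → ∀ {r s} → r ≢ s →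
                 ¬ lookup A r ⊏ lookup A s → lookup A s ⊏ lookup A r
  distinct-≮⇒> A distinct {r} {s} r≢s Ar⊀As with compare (lookup A r) (lookup A s)
  ... | tri< Ar⊏As _ _ = ⊥-elim (Ar⊀As Ar⊏As)
  ... | tri≈ _ Ar≈As _ = ⊥-elim (distinct r s r≢s Ar≈As)
  ... | tri> _ _ As⊏Ar = As⊏Ar

  swap-inversions-inverted : ∀ {n} (A : Vec X n) {p q} → q <ᶠ p → lookup A p ⊏ lookup A q →
                             inversions O (swap O A p q) < inversions O A
  swap-inversions-inverted A {p} {q} q<p Ap⊏Aq
    rewrite inversions≡inversionsOf A | inversions≡inversionsOf (swap O A p q) =
    inversionsOf-exchange-inverted q<p (exchange-sym (swap-exchange A (<ᶠ⇒≢ q<p ∘ sym))) Ap⊏Aq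

  swap-inversions-ordered : ∀ {n} (A : Vec X n) {p q} → p <ᶠ q → lookup A p ⊏ lookup A q →
    (∀ r → p <ᶠ r → r <ᶠ q → lookup A r ⊏ lookup A p) → inversions O (swap O A p q) ≤ suc (inversions O A)
  swap-inversions-ordered A {p} {q} p<q Ap⊏Aq below
    rewrite inversions≡inversionsOf A | inversions≡inversionsOf (swap O A p q) =
    inversionsOf-exchange-ordered p<q (swap-exchange A (<ᶠ⇒≢ p<q)) Ap⊏Aq below

  module FirstPass {n : ℕ} (A₀ : Vec X (suc n)) (distinct₀ : Distinct O A₀) where

    -- m ∸ 1 counts the steps with j ≥ 1: step j = 0 compares A[0] with itself and never swaps.
    Invariant : ℕ → Vec X (suc n) × ℕ → Set (ℓ₁ ⊔ ℓ₂)
    Invariant m (A , k) = Distinct O A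
                        × (∀ r → toℕ r < m ∸ 1 → lookup A (suc r) ⊏ lookup A zero)
                        × k + inversions O A ≤ inversions O A₀ + 2 * (m ∸ 1)

    step-invariant : ∀ x s → Invariant (toℕ x) s → Invariant (suc (toℕ x)) (step O zero s x)
    step-invariant x (A , k) inv with lookup A zero <? lookup A x
    step-invariant zero (A , k) _ | yes A₀⊏A₀ = ⊥-elim (irrefl Eq.refl A₀⊏A₀)
    step-invariant zero (A , k) (distinct , _ , budget) | no _ = distinct , (λ _ ()) , budget
    step-invariant (suc x) (A , k) (distinct , below , budget) | yes A₀⊏Ax =
        swap-distinct A (λ ()) distinct , below′ , budget′
      where
      e = swap-exchange A {zero} {suc x} (λ ())
      open Exchange e
      below′ : ∀ r → toℕ r < suc (toℕ x) → lookup (swap O A zero (suc x)) (suc r) ⊏ lookup (swap O A zero (suc x)) zero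
      below′ r r≤x with toℕ<1+toℕ⇒<∨≡ r≤x
      ... | inj₂ refl = subst₂ _⊏_ (sym at-q) (sym at-p) A₀⊏Ax
      ... | inj₁ r<x = subst₂ _⊏_ (sym (elsewhere (λ ()) (<⇒≢ r<x ∘ cong toℕ ∘ Fin.suc-injective))) (sym at-p)
                                  (⊏-trans (below r r<x) A₀⊏Ax)
      fewer-than-two-more : inversions O (swap O A zero (suc x)) ≤ suc (inversions O A)
      fewer-than-two-more = swap-inversions-ordered A z<s A₀⊏Ax λ { (suc r) _ (s<s r<x) → below r r<x }
      budget′ : suc k + inversions O (swap O A zero (suc x)) ≤ inversions O A₀ + 2 * suc (toℕ x)
      budget′ = begin
        suc k + inversions O (swap O A zero (suc x)) ≤⟨ +-monoʳ-≤ (suc k) fewer-than-two-more ⟩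
        suc k + suc (inversions O A)                 ≡⟨ cong suc (+-suc k _) ⟩
        2 + (k + inversions O A)                     ≤⟨ +-monoʳ-≤ 2 budget ⟩
        2 + (inversions O A₀ + 2 * toℕ x)            ≡⟨ x∙yz≈y∙xz 2 (inversions O A₀) _ ⟩
        inversions O A₀ + (2 + 2 * toℕ x)            ≡⟨ cong (inversions O A₀ +_) (*-suc 2 (toℕ x)) ⟨
        inversions O A₀ + 2 * suc (toℕ x)           ∎
        where open ≤-Reasoning
    step-invariant (suc x) (A , k) (distinct , below , budget) | no A₀⊀Ax = distinct , below′ , budget′
      where
      below′ : ∀ r → toℕ r < suc (toℕ x) → lookup A (suc r) ⊏ lookup A zero
      below′ r r≤x with toℕ<1+toℕ⇒<∨≡ r≤x
      ... | inj₁ r<x = below r r<x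
      ... | inj₂ refl = distinct-≮⇒> A distinct (λ ()) A₀⊀Ax
      budget′ = ≤-trans budget (+-monoʳ-≤ (inversions O A₀) (*-monoʳ-≤ 2 (n≤1+n (toℕ x))))

    invariant-after : Invariant (suc n) (inner O (A₀ , 0) zero)
    invariant-after = foldl-tabulate-invariant Invariant (λ x → x) step-invariant
      (distinct₀ , (λ _ ()) , m≤m+n (inversions O A₀) 0)

  module LaterPass {n : ℕ} (C : ℕ) (x : Fin n) (k₀ : ℕ) where

    -- In pass suc x the maximum stays at x until step j = x, whose swap moves it to suc x.
    Invariant : ℕ → Vec X (suc n) × ℕ → Set (ℓ₁ ⊔ ℓ₂)
    Invariant t (B , k) = Distinct O B × k + inversions O B ≤ C
                        × (t ≤ toℕ x × IsMax B (inject₁ x) × k₀ ≤ k ⊎ toℕ x < t × IsMax B (suc x) × k₀ < k)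

    suc≢inject₁ : suc x ≢ inject₁ x
    suc≢inject₁ eq = <⇒≢ (n<1+n (toℕ x)) (trans (sym (toℕ-inject₁ x)) (cong toℕ (sym eq)))

    inject₁≢ : ∀ {y} → toℕ y < toℕ x → inject₁ x ≢ y
    inject₁≢ y<x refl = <⇒≢ y<x (toℕ-inject₁ x)

    toℕ≡⇒≡inject₁ : ∀ {y} → toℕ y ≡ toℕ x → y ≡ inject₁ x
    toℕ≡⇒≡inject₁ y≡x = toℕ-injective (trans y≡x (sym (toℕ-inject₁ x)))

    step-invariant : ∀ y s → Invariant (toℕ y) s → Invariant (suc (toℕ y)) (step O (suc x) s y)
    step-invariant y (B , k) (distinct , budget , phase) with lookup B (suc x) <? lookup B y
    step-invariant y (B , k) (distinct , budget , inj₂ (_ , max , _)) | yes Bi⊏By = ⊥-elim (max y Bi⊏By)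
    step-invariant y (B , k) (distinct , budget , inj₁ (y≤x , max , k₀≤k)) | yes Bi⊏By =
        swap-distinct B i≢y distinct , budget′ , phase′ (m≤n⇒m<n∨m≡n y≤x)
      where
      i≢y : suc x ≢ y
      i≢y refl = 1+n≰n y≤x
      open Exchange (swap-exchange B i≢y)
      budget′ : suc k + inversions O (swap O B (suc x) y) ≤ C
      budget′ = begin
        suc k + inversions O (swap O B (suc x) y)   ≡⟨ +-suc k _ ⟨
        k + suc (inversions O (swap O B (suc x) y)) ≤⟨ +-monoʳ-≤ k (swap-inversions-inverted B (s≤s y≤x) Bi⊏By) ⟩
        k + inversions O B                          ≤⟨ budget ⟩
        C                                           ∎
        where open ≤-Reasoning
      phase′ : toℕ y < toℕ x ⊎ toℕ y ≡ toℕ x → _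
      phase′ (inj₁ y<x) = inj₁ (y<x , swap-isMax B i≢y max (elsewhere (suc≢inject₁ ∘ sym) (inject₁≢ y<x)) , m≤n⇒m≤1+n k₀≤k)
      phase′ (inj₂ y≡x) = inj₂ ( s≤s (≤-reflexive (sym y≡x))
                               , swap-isMax B i≢y max (trans at-p (cong (lookup B) (toℕ≡⇒≡inject₁ y≡x)))
                               , s≤s k₀≤k )
    step-invariant y (B , k) (distinct , budget , inj₂ (x<y , max , k₀<k)) | no _ =
      distinct , budget , inj₂ (m≤n⇒m≤1+n x<y , max , k₀<k)
    step-invariant y (B , k) (distinct , budget , inj₁ (y≤x , max , k₀≤k)) | no Bi⊀By with m≤n⇒m<n∨m≡n y≤x
    ... | inj₁ y<x = distinct , budget , inj₁ (y<x , max , k₀≤k)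
    ... | inj₂ y≡x = ⊥-elim (max (suc x) (distinct-≮⇒> B distinct suc≢inject₁ Bi⊀Bx))
      where
      Bi⊀Bx : ¬ lookup B (suc x) ⊏ lookup B (inject₁ x)
      Bi⊀Bx = subst (λ r → ¬ lookup B (suc x) ⊏ lookup B r) (toℕ≡⇒≡inject₁ y≡x) Bi⊀By

    pass : ∀ {B} → Distinct O B → IsMax B (inject₁ x) → k₀ + inversions O B ≤ C →
           let (B′ , k′) = inner O (B , k₀) (suc x)
           in Distinct O B′ × IsMax B′ (suc x) × k′ + inversions O B′ ≤ C × k₀ < k′
    pass distinct max budget
      with foldl-tabulate-invariant Invariant (λ y → y) step-invariant (distinct , budget , inj₁ (z≤n , max , ≤-refl))
    ... | distinct′ , budget′ , inj₂ (_ , max′ , k₀<k′) = distinct′ , max′ , budget′ , k₀<k′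
    ... | _ , _ , inj₁ (n<x , _) = ⊥-elim (<⇒≱ (toℕ<n x) (≤-trans (n≤1+n n) n<x))

  module LaterPasses {n : ℕ} (C k₁ : ℕ) where

    Invariant : ℕ → Vec X (suc n) × ℕ → Set (ℓ₁ ⊔ ℓ₂)
    Invariant m (B , k) = Distinct O B × (∀ r → toℕ r ≡ m → IsMax B r) × k + inversions O B ≤ C × k₁ + m ≤ k

    step-invariant : ∀ (x : Fin n) s → Invariant (toℕ x) s → Invariant (suc (toℕ x)) (inner O s (suc x))
    step-invariant x (B , k) (distinct , max , budget , progress)
      with LaterPass.pass C x k distinct (max (inject₁ x) (toℕ-inject₁ x)) budget
    ... | distinct′ , max′ , budget′ , k<k′ =
      distinct′ , (λ r r≡1+x → subst (IsMax (proj₁ (inner O (B , k) (suc x)))) (toℕ-injective (sym r≡1+x)) max′) , budget′ ,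
      ≤-trans (≤-reflexive (+-suc k₁ (toℕ x))) (≤-trans (s≤s progress) k<k′)

  firstPassSwaps : ∀ {n} → Vec X (suc n) → ℕ
  firstPassSwaps A = proj₂ (inner O (A , 0) zero)

  swaps-bounds : ∀ {n} (A : Vec X (suc n)) → Distinct O A →
                 firstPassSwaps A + n ≤ swaps O A × swaps O A ≤ inversions O A + 2 * n
  swaps-bounds {n} A distinct with FirstPass.invariant-after A distinct
  ... | distinct₁ , below₁ , budget₁
    with foldl-tabulate-invariant (LaterPasses.Invariant C (firstPassSwaps A)) suc (LaterPasses.step-invariant C (firstPassSwaps A))
           (distinct₁ , max₁ , budget₁ , ≤-reflexive (+-identityʳ (firstPassSwaps A)))
    where
    C = inversions O A + 2 * n
    max₁ : ∀ r → toℕ r ≡ 0 → IsMax (proj₁ (inner O (A , 0) zero)) r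
    max₁ zero _ zero = irrefl Eq.refl
    max₁ zero _ (suc r) = asym (below₁ r (toℕ<n r))
  ... | _ , _ , budget , progress = progress , ≤-trans (m≤m+n _ _) budget

  inversions-ascending : ∀ {n} (A : Vec X n) → (∀ {p q} → p <ᶠ q → lookup A p ⊏ lookup A q) → inversions O A ≡ 0
  inversions-ascending A ascending rewrite inversions≡inversionsOf A = sum-zero λ p → sum-zero λ q → not-inverted p q
    where
    not-inverted : ∀ p q → invertedAt (lookup A) p q ≡ 0
    not-inverted p q with p <ᶠ? q
    ... | yes p<q = trans (inverted-< p<q _ _) (⟦⟧-no (lookup A q <? lookup A p) (asym (ascending p<q)))
    ... | no p≮q = inverted-≮ p≮q _ _

module _ where
  -- step compares with the order's own _<?_, which is not Data.Nat's.
  open StrictTotalOrder <-strictTotalOrder using (_<?_)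

  ascending : ∀ n → Vec ℕ n
  ascending n = Vec.tabulate toℕ

  lookup-ascending : ∀ {n} (r : Fin n) → lookup (ascending n) r ≡ toℕ r
  lookup-ascending = lookup∘tabulate toℕ

  ascending-distinct : ∀ {n} → Distinct <-strictTotalOrder (ascending n)
  ascending-distinct p q p≢q Ap≡Aq = p≢q (toℕ-injective (trans (sym (lookup-ascending p)) (trans Ap≡Aq (lookup-ascending q))))

  ascending-inversions : ∀ {n} → inversions <-strictTotalOrder (ascending n) ≡ 0
  ascending-inversions {n} = inversions-ascending <-strictTotalOrder (ascending n)
    λ {p} {q} p<q → subst₂ _<_ (sym (lookup-ascending p)) (sym (lookup-ascending q)) p<q

  module AscendingFirstPass (n : ℕ) where

    Invariant : ℕ → Vec ℕ (suc n) × ℕ → Set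
    Invariant m (A , k) = lookup A zero ≡ m ∸ 1 × (∀ r → m ≤ toℕ r → lookup A r ≡ toℕ r) × k ≡ m ∸ 1

    step-invariant : ∀ x s → Invariant (toℕ x) s → Invariant (suc (toℕ x)) (step <-strictTotalOrder zero s x)
    step-invariant x (A , k) inv with lookup A zero <? lookup A x
    step-invariant zero (A , k) _ | yes A₀<A₀ = ⊥-elim (<-irrefl refl A₀<A₀)
    step-invariant zero (A , k) (A₀≡0 , untouched , k≡0) | no _ = A₀≡0 , (λ r _ → untouched r z≤n) , k≡0
    step-invariant (suc x) (A , k) (A₀≡x , untouched , k≡x) | yes _ =
        trans at-p (untouched (suc x) ≤-refl) ,
        (λ r 2+x≤r → trans (elsewhere (λ { refl → n≮0 2+x≤r }) (λ { refl → 1+n≰n 2+x≤r })) (untouched r (<⇒≤ 2+x≤r))) ,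
        cong suc k≡x
      where open Exchange (swap-exchange <-strictTotalOrder A {zero} {suc x} (λ ()))
    step-invariant (suc x) (A , k) (A₀≡x , untouched , _) | no A₀≮Ax =
      ⊥-elim (A₀≮Ax (subst₂ _<_ (sym A₀≡x) (sym (untouched (suc x) ≤-refl)) ≤-refl))

    firstPassSwaps-ascending : firstPassSwaps <-strictTotalOrder (ascending (suc n)) ≡ n
    firstPassSwaps-ascending with foldl-tabulate-invariant Invariant (λ x → x) {s = ascending (suc n) , 0} step-invariant
                                    (lookup-ascending {suc n} zero , (λ r _ → lookup-ascending r) , refl)
    ... | _ , _ , k≡n = k≡n

  ascending-swaps : ∀ n → swaps <-strictTotalOrder (ascending (suc n)) ≡ inversions <-strictTotalOrder (ascending (suc n)) + 2 * n
  ascending-swaps n = ≤-antisym (proj₂ bounds) (begin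
    inversions <-strictTotalOrder (ascending (suc n)) + 2 * n   ≡⟨ cong (_+ 2 * n) (ascending-inversions {suc n}) ⟩
    n + (n + 0)                                      ≡⟨ cong (n +_) (+-identityʳ n) ⟩
    n + n                                            ≡⟨ cong (_+ n) (AscendingFirstPass.firstPassSwaps-ascending n) ⟨
    firstPassSwaps <-strictTotalOrder (ascending (suc n)) + n   ≤⟨ proj₁ bounds ⟩
    swaps <-strictTotalOrder (ascending (suc n))                ∎)
    where
    open ≤-Reasoning
    bounds = swaps-bounds <-strictTotalOrder (ascending (suc n)) ascending-distinct

mainTheorem4 : {c ℓ₁ ℓ₂ : Level} (n : ℕ) → n ≥ 1 →
    ((O : StrictTotalOrder c ℓ₁ ℓ₂) →
      (A : Vec (StrictTotalOrder.Carrier O) n) → Distinct O A →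
        swaps O A ≤ inversions O A + 2 * (n ∸ 1))
    × Σ (Vec ℕ n)
        (λ A → Distinct <-strictTotalOrder A ×
          (swaps <-strictTotalOrder A ≡ inversions <-strictTotalOrder A + 2 * (n ∸ 1)))
mainTheorem4 zero ()
mainTheorem4 (suc n) _ =
  (λ O A distinct → proj₂ (swaps-bounds O A distinct)) ,
  (ascending (suc n) , ascending-distinct , ascending-swaps n)
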